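{- Let $\mathcal{G}$ be a triangular choice multigraph on $[m]$. Let $A_1,\dots,A_k$ be the maximal closed sets of $\mathcal{G}$, with sizes $a_1\leq\cdots\leq a_k$ respectively. Fix $i\in[k]$ and $v_i\in A_i$, and for each $j\in[k]\setminus\{i\}$ let $s_j=\sum_{j'\in[j]\setminus\{i\}}a_{j'}$. Then $$\sum_{u\in[m]\setminus A_i}2^{m^{\mathcal{G}}_{uv_i}}\leq\sum_{j\in[k]\setminus\{i\}}a_j\,2^{m-a_i-s_j}.$$
   Context: A triangular choice multigraph (TCM) $\mathcal{G}$ on $[m]$ is obtained by choosing, for every 3-element subset $\{u,v,w\}\subseteq[m]$, exactly one of the pairs $uv,uw,vw$ (the pair "chosen in triangle $uvw$") and adding one copy of it as an edge; $m^{\mathcal{G}}_{xy}$ is the multiplicity of $xy$. A set $S\subseteq[m]$ is closed if for all distinct $x,y\in S$ and all $z\notin S$, the pair $xy$ is chosen in triangle $xyz$. A closed set $S$ is maximal if the only proper closed subset of $[m]$ containing $S$ is $S$ itself. -}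

module Defs where

open import Data.Nat using (ℕ; _+_; _*_; _∸_; _^_) renaming (_≤_ to _≤ℕ_)
open import Data.Fin using (Fin; toℕ; _≟_)
open import Data.Fin.Subset using (Subset; _∈_; _∉_; _⊆_; ∣_∣; ⊤)
open import Data.Fin.Subset.Properties using (_∈?_)
open import Data.List using (List; allFin; map; filter; length)
open import Data.Nat.ListAction using (sum)
open import Data.Product using (_×_; ∃)
open import Data.Sum using (_⊎_)
open import Data.Bool using (if_then_else_)
open import Relation.Nullary using (¬_; does; ¬?)
open import Relation.Nullary.Decidable using (_×-dec_)
open import Relation.Binary.PropositionalEquality using (_≡_; _≢_)

ΣFin : (n : ℕ) → (Fin n → ℕ) → ℕ
ΣFin n f = sum (map f (allFin n))

-- For distinct x y z, the pair chosen in the triangle {x,y,z} is encoded by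
-- the vertex it omits: omit x y z is the vertex of the triangle NOT in the
-- chosen pair.
record TCM (m : ℕ) : Set where
  field
    omit : Fin m → Fin m → Fin m → Fin m
    omit-in : ∀ x y z → x ≢ y → y ≢ z → x ≢ z →
              (omit x y z ≡ x ⊎ omit x y z ≡ y ⊎ omit x y z ≡ z)
    omit-swap₁₂ : ∀ x y z → x ≢ y → y ≢ z → x ≢ z → omit x y z ≡ omit y x z
    omit-swap₂₃ : ∀ x y z → x ≢ y → y ≢ z → x ≢ z → omit x y z ≡ omit x z y

module _ {m : ℕ} (G : TCM m) where
  open TCM G

  Chosen : Fin m → Fin m → Fin m → Set
  Chosen x y z = omit x y z ≡ z

  mult : Fin m → Fin m → ℕ
  mult x y = length (filter (λ z → ¬? (z ≟ x) ×-dec (¬? (z ≟ y) ×-dec (omit x y z ≟ z))) (allFin m))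

  Closed : Subset m → Set
  Closed S = ∀ x y z → x ∈ S → y ∈ S → x ≢ y → z ∉ S → Chosen x y z

  MaximalClosed : Subset m → Set
  MaximalClosed S = Closed S × S ≢ ⊤ × (∀ T → Closed T → T ≢ ⊤ → S ⊆ T → T ≡ S)

  lhsSum : Subset m → Fin m → ℕ
  lhsSum S v = ΣFin m (λ u → if does (u ∈? S) then 0 else 2 ^ mult u v)

sIdx : {k : ℕ} → (Fin k → ℕ) → Fin k → Fin k → ℕ
sIdx {k} a i j = ΣFin k (λ j' → if does (toℕ j' Data.Nat.≤? toℕ j) then (if does (j' ≟ i) then 0 else a j') else 0)

rhsSum : (m : ℕ) {k : ℕ} → (Fin k → ℕ) → Fin k → ℕ
rhsSum m {k} a i = ΣFin k (λ j → if does (j ≟ i) then 0 else a j * 2 ^ (m ∸ a i ∸ sIdx a i j))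

-- Every vertex outside A i lies in exactly one other maximal closed set, because closed sets
-- that meet are nested. Orient u → w when uv is chosen in the triangle uvw: this gives an
-- oriented graph on [m] ∖ A i with no arc inside a class, in which m_{uv} ≤ outdeg u. It
-- therefore suffices that every oriented multipartite graph with class sizes c₁ ≤ ⋯ ≤ c_r
-- satisfies ∑_u 2^{outdeg u} ≤ ∑_j c_j 2^{c_{j+1} + ⋯ + c_r}. Delete a vertex x of maximum
-- out-degree D: the left-hand side drops by 2^D plus 2^{outdeg u - 1} ≤ 2^{D-1} for each
-- in-neighbour u of x, in total at most 2^{D + indeg x} ≤ 2^T, where T counts the vertices
-- outside the class of x (among them the out- and in-neighbours of x, distinct by asymmetry).
-- If that class is relabelled to be the first one of its size, the sizes stay sorted and the
-- right-hand side drops by at least 2^T.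
module Submission where

open import Defs
open import Data.Nat using (ℕ) renaming (_≤_ to _≤ℕ_)
open import Data.Fin using (Fin; toℕ)
open import Data.Fin.Subset using (Subset; _∈_; ∣_∣)
open import Data.Product using (∃)
open import Relation.Binary.PropositionalEquality using (_≡_)

open import Data.Bool using (Bool; true; false; _∧_; not; if_then_else_)
open import Data.Bool.Properties using (∧-conicalˡ) renaming (_≟_ to _≟ᴮ_)
open import Data.Fin using (zero; suc; _≟_)
open import Data.Fin.Permutation as Perm using (Permutation; _⟨$⟩ʳ_; _⟨$⟩ˡ_)
import Data.Fin.Permutation.Components as PC
open import Data.Fin.Properties using (any?; all?) renaming (suc-injective to Fin-suc-injective)
open import Data.Fin.Subset using (_∉_; _⊆_; ⊤; ⁅_⁆; ∁)
open import Data.Fin.Subset.Properties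
  using (_∈?_; _⊆?_; _⊂?_; anySubset?; ∣∁p∣≡n∸∣p∣; p⊂q⇒∣p∣<∣q∣; ⊆-antisym; ∣p∣≤n; ∣p∣≡n⇒p≡⊤; ∈⊤; x∈⁅x⁆; x∈⁅y⁆⇒x≡y)
open import Data.List using (map; filter; length; tabulate)
import Data.Nat.ListAction as List
open import Data.Nat using (zero; suc; _+_; _*_; _∸_; _^_; _≤_; _<_; z≤n; s≤s; s≤s⁻¹; _≤?_)
open import Data.Nat.Properties hiding (_≟_)
open import Data.Nat.Properties using () renaming (_≟_ to _≟ℕ_)
open import Data.Nat.Solver using (module +-*-Solver)
open import Algebra.Properties.CommutativeSemigroup +-commutativeSemigroup
  using (x∙yz≈y∙xz; xy∙z≈xz∙y; xy∙z≈x∙zy)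
open import Algebra.Properties.Semiring.Sum +-*-semiring
  using (sum; sum-syntax; sum-cong-≗; ∑-distrib-+; ∑-comm; *-distribˡ-sum; sum-replicate-zero)
open import Data.Product using (_×_; _,_; proj₁; proj₂)
open import Data.Sum using (_⊎_; inj₁; inj₂)
open import Data.Vec using ([]; _∷_)
open import Data.Vec.Properties using (≡-dec)
open import Function using (_∘_; const)
open import Function.Bundles using (mk⇔)
open import Relation.Binary.PropositionalEquality
  using (_≢_; _≗_; refl; sym; trans; cong; cong₂; subst; subst₂; module ≡-Reasoning)
open import Relation.Nullary using (¬_; ¬?; Dec; yes; no; does; contradiction)
open import Relation.Nullary.Decidable
  using (dec-true; dec-false; does-⇔; decidable-stable; _×-dec_; _→-dec_)
open import Relation.Unary using (Decidable)

-- Finite sums and searches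

𝟙[_] : Bool → ℕ
𝟙[ true ]  = 1
𝟙[ false ] = 0

sum-mono-≤ : ∀ {n} {f g : Fin n → ℕ} → (∀ x → f x ≤ g x) → sum f ≤ sum g
sum-mono-≤ {zero}  f≤g = z≤n
sum-mono-≤ {suc n} f≤g = +-mono-≤ (f≤g zero) (sum-mono-≤ (f≤g ∘ suc))

sum-pick : ∀ {n} (f : Fin n → ℕ) x →
           sum f ≡ f x + sum (λ y → if does (y ≟ x) then 0 else f y)
sum-pick {suc n} f zero    = refl
sum-pick {suc n} f (suc x) = begin
  f zero + sum (f ∘ suc)        ≡⟨ cong (f zero +_) (sum-pick (f ∘ suc) x) ⟩
  f zero + (f (suc x) + rest)   ≡⟨ x∙yz≈y∙xz (f zero) (f (suc x)) rest ⟩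
  f (suc x) + (f zero + rest)   ∎
  where
  open ≡-Reasoning
  rest = sum (λ y → if does (y ≟ x) then 0 else f (suc y))

sum-tabulate : ∀ {A : Set} n (g : Fin n → A) (f : A → ℕ) →
               List.sum (map f (tabulate g)) ≡ ∑[ x < n ] f (g x)
sum-tabulate zero    g f = refl
sum-tabulate (suc n) g f = cong (f (g zero) +_) (sum-tabulate n (g ∘ suc) f)

length-filter-tabulate : ∀ {A : Set} n (g : Fin n → A) {P : A → Set} (P? : Decidable P) →
                         length (filter P? (tabulate g)) ≡ ∑[ x < n ] 𝟙[ does (P? (g x)) ]
length-filter-tabulate zero    g P? = refl
length-filter-tabulate (suc n) g P? with does (P? (g zero))
... | true  = cong suc (length-filter-tabulate n (g ∘ suc) P?)
... | false = length-filter-tabulate n (g ∘ suc) P?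

ΣFin≡sum : ∀ n (f : Fin n → ℕ) → ΣFin n f ≡ sum f
ΣFin≡sum n f = sum-tabulate n (λ x → x) f

module _ {m : ℕ} where

  ∑∈ : (Fin m → Bool) → (Fin m → ℕ) → ℕ
  ∑∈ W g = ∑[ u < m ] (if W u then g u else 0)

  size : (Fin m → Bool) → ℕ
  size W = ∑∈ W (const 1)

  infixl 5 _─_
  _─_ : (Fin m → Bool) → Fin m → (Fin m → Bool)
  (W ─ x) u = W u ∧ not (does (u ≟ x))

  ∈─⇒∈ : ∀ W x {u} → (W ─ x) u ≡ true → W u ≡ true
  ∈─⇒∈ W x {u} = ∧-conicalˡ (W u) _

  ∑∈-cong : ∀ W {f g : Fin m → ℕ} → (∀ u → W u ≡ true → f u ≡ g u) → ∑∈ W f ≡ ∑∈ W g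
  ∑∈-cong W {f} {g} f≡g = sum-cong-≗ pointwise
    where
    pointwise : ∀ u → (if W u then f u else 0) ≡ (if W u then g u else 0)
    pointwise u with W u in wu
    ... | true  = f≡g u wu
    ... | false = refl

  ∑∈-mono-≤ : ∀ W {f g : Fin m → ℕ} → (∀ u → W u ≡ true → f u ≤ g u) → ∑∈ W f ≤ ∑∈ W g
  ∑∈-mono-≤ W {f} {g} f≤g = sum-mono-≤ pointwise
    where
    pointwise : ∀ u → (if W u then f u else 0) ≤ (if W u then g u else 0)
    pointwise u with W u in wu
    ... | true  = f≤g u wu
    ... | false = z≤n

  ∑∈-distrib-+ : ∀ W (f g : Fin m → ℕ) → ∑∈ W (λ u → f u + g u) ≡ ∑∈ W f + ∑∈ W g
  ∑∈-distrib-+ W f g = trans (sum-cong-≗ pointwise) (∑-distrib-+ {m} _ _)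
    where
    pointwise : ∀ u → (if W u then f u + g u else 0) ≡ (if W u then f u else 0) + (if W u then g u else 0)
    pointwise u with W u
    ... | true  = refl
    ... | false = refl

  *-distribˡ-∑∈ : ∀ W c (f : Fin m → ℕ) → c * ∑∈ W f ≡ ∑∈ W (λ u → c * f u)
  *-distribˡ-∑∈ W c f = trans (*-distribˡ-sum {m} c _) (sum-cong-≗ pointwise)
    where
    pointwise : ∀ u → c * (if W u then f u else 0) ≡ (if W u then c * f u else 0)
    pointwise u with W u
    ... | true  = refl
    ... | false = *-zeroʳ c

  ∑∈-none : ∀ W g → (∀ u → W u ≡ false) → ∑∈ W g ≡ 0
  ∑∈-none W g none = trans (sum-cong-≗ pointwise) (sum-replicate-zero m)
    where
    pointwise : ∀ u → (if W u then g u else 0) ≡ 0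
    pointwise u rewrite none u = refl

  ∑∈-remove : ∀ W g x → W x ≡ true → ∑∈ W g ≡ g x + ∑∈ (W ─ x) g
  ∑∈-remove W g x wx = trans (sum-pick _ x) (cong₂ _+_ picked (sum-cong-≗ pointwise))
    where
    picked : (if W x then g x else 0) ≡ g x
    picked rewrite wx = refl
    pointwise : ∀ u → (if does (u ≟ x) then 0 else (if W u then g u else 0)) ≡ (if (W ─ x) u then g u else 0)
    pointwise u with does (u ≟ x) | W u
    ... | true  | true  = refl
    ... | true  | false = refl
    ... | false | true  = refl
    ... | false | false = refl

size-∈ : ∀ {n} (p : Subset n) → size (λ u → does (u ∈? p)) ≡ ∣ p ∣
size-∈ []          = refl
size-∈ (true ∷ p)  = cong suc (size-∈ p)
size-∈ (false ∷ p) = size-∈ p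

size-∉ : ∀ {n} (p : Subset n) → size (λ u → not (does (u ∈? p))) ≡ n ∸ ∣ p ∣
size-∉ p = trans (∁-size p) (∣∁p∣≡n∸∣p∣ p)
  where
  ∁-size : ∀ {n} (p : Subset n) → size (λ u → not (does (u ∈? p))) ≡ ∣ ∁ p ∣
  ∁-size []          = refl
  ∁-size (true ∷ p)  = ∁-size p
  ∁-size (false ∷ p) = cong suc (∁-size p)

MaximumOn : ∀ {m} → (Fin m → Bool) → (Fin m → ℕ) → Set
MaximumOn W g = ∃ λ x → W x ≡ true × ∀ u → W u ≡ true → g u ≤ g x

argmax : ∀ {m} (W : Fin m → Bool) (g : Fin m → ℕ) → (∀ u → W u ≡ false) ⊎ MaximumOn W g
argmax {zero}  W g = inj₁ λ ()
argmax {suc m} W g with argmax (W ∘ suc) (g ∘ suc) | W zero in w₀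
... | inj₁ none            | false = inj₁ λ { zero → w₀ ; (suc u) → none u }
... | inj₁ none            | true  = inj₂ (zero , w₀ , λ
  { zero    _  → ≤-refl
  ; (suc u) wu → contradiction (trans (sym (none u)) wu) λ () })
... | inj₂ (x , wx , max) | false = inj₂ (suc x , wx , λ
  { zero    w₀′ → contradiction (trans (sym w₀) w₀′) λ ()
  ; (suc u) wu  → max u wu })
... | inj₂ (x , wx , max) | true with g (suc x) ≤? g zero
...   | yes x≤0 = inj₂ (zero , w₀ , λ { zero _ → ≤-refl ; (suc u) wu → ≤-trans (max u wu) x≤0 })
...   | no  x≰0 = inj₂ (suc x , wx , λ { zero _ → <⇒≤ (≰⇒> x≰0) ; (suc u) wu → max u wu })

least-witness : ∀ {r} {P : Fin r → Set} → Decidable P → ∀ p → P p →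
                ∃ λ q → P q × (∀ j → toℕ j < toℕ q → ¬ P j)
least-witness {suc r} P? p Pp with P? zero
... | yes P₀ = zero , P₀ , λ j ()
least-witness {suc r} P? zero    Pp | no ¬P₀ = contradiction Pp ¬P₀
least-witness {suc r} P? (suc p) Pp | no ¬P₀ with least-witness (P? ∘ suc) p Pp
... | q , Pq , below = suc q , Pq , λ { zero _ → ¬P₀ ; (suc j) (s≤s j<q) → below j j<q }

-- The bound ∑_j c_j 2^{c_{j+1} + ⋯ + c_r}

classBound : ∀ r → (Fin r → ℕ) → ℕ
classBound zero    c = 0
classBound (suc r) c = c zero * 2 ^ sum (c ∘ suc) + classBound r (c ∘ suc)

classBound-cong : ∀ r {c c′ : Fin r → ℕ} → c ≗ c′ → classBound r c ≡ classBound r c′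
classBound-cong zero    c≗c′ = refl
classBound-cong (suc r) c≗c′ =
  cong₂ _+_ (cong₂ (λ x s → x * 2 ^ s) (c≗c′ zero) (sum-cong-≗ (c≗c′ ∘ suc)))
            (classBound-cong r (c≗c′ ∘ suc))

prefixSum : ∀ {r} → (Fin r → ℕ) → Fin r → ℕ
prefixSum {r} c j = ∑[ l < r ] (if does (toℕ l ≤? toℕ j) then c l else 0)

classBound-closed : ∀ r (c : Fin r → ℕ) → classBound r c ≡ ∑[ j < r ] (c j * 2 ^ (sum c ∸ prefixSum c j))
classBound-closed zero    c = refl
classBound-closed (suc r) c =
  cong₂ _+_ (cong (λ e → c zero * 2 ^ e) (sym first-exponent))
            (trans (classBound-closed r (c ∘ suc)) (sum-cong-≗ λ j → cong (λ e → c (suc j) * 2 ^ e) (sym (later-exponent j))))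
  where
  S = sum (c ∘ suc)
  prefix-zero : prefixSum c zero ≡ c zero
  prefix-zero = trans (cong (c zero +_) (sum-replicate-zero r)) (+-identityʳ (c zero))
  first-exponent : sum c ∸ prefixSum c zero ≡ S
  first-exponent = trans (cong (sum c ∸_) prefix-zero) (m+n∸m≡n (c zero) S)
  prefix-suc : ∀ j → prefixSum c (suc j) ≡ c zero + prefixSum (c ∘ suc) j
  prefix-suc j = cong (c zero +_) (sum-cong-≗ λ l →
    cong (λ b → if b then c (suc l) else 0) (does-⇔ (mk⇔ s≤s⁻¹ s≤s) (suc (toℕ l) ≤? suc (toℕ j)) (toℕ l ≤? toℕ j)))
  later-exponent : ∀ j → sum c ∸ prefixSum c (suc j) ≡ S ∸ prefixSum (c ∘ suc) j
  later-exponent j = trans (cong (sum c ∸_) (prefix-suc j)) ([m+n]∸[m+o]≡n∸o (c zero) S _)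

DecrementedAt : ∀ {r} → Fin r → (Fin r → ℕ) → (Fin r → ℕ) → Set
DecrementedAt q c c′ = c q ≡ suc (c′ q) × (∀ j → j ≢ q → c′ j ≡ c j)

DecrementedAt-tail : ∀ {r q} {c c′ : Fin (suc r) → ℕ} →
                     DecrementedAt (suc q) c c′ → DecrementedAt q (c ∘ suc) (c′ ∘ suc)
DecrementedAt-tail (cq , rest) = cq , λ j j≢q → rest (suc j) (j≢q ∘ Fin-suc-injective)

DecrementedAt-resp-≗ : ∀ {r q} {c d d′ : Fin r → ℕ} → d′ ≗ d → DecrementedAt q c d → DecrementedAt q c d′
DecrementedAt-resp-≗ {q = q} d′≗d (cq , rest) = trans cq (cong suc (sym (d′≗d q))) , λ j j≢q → trans (d′≗d j) (rest j j≢q)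

sum-decrement : ∀ {r q} {c c′ : Fin r → ℕ} → DecrementedAt q c c′ → sum c ≡ suc (sum c′)
sum-decrement {q = q} {c} {c′} (cq , rest) = begin
  sum c                     ≡⟨ sum-pick c q ⟩
  c q + rest-sum c          ≡⟨ cong₂ _+_ cq (sum-cong-≗ same-rest) ⟩
  suc (c′ q + rest-sum c′)  ≡⟨ cong suc (sum-pick c′ q) ⟨
  suc (sum c′)              ∎
  where
  open ≡-Reasoning
  rest-sum : (Fin _ → ℕ) → ℕ
  rest-sum f = sum (λ j → if does (j ≟ q) then 0 else f j)
  same-rest : ∀ j → (if does (j ≟ q) then 0 else c j) ≡ (if does (j ≟ q) then 0 else c′ j)
  same-rest j with j ≟ q
  ... | yes _   = refl
  ... | no  j≢q = sym (rest j j≢q)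

2^a≤a*2^b+1 : ∀ a b → a ≤ suc b → 2 ^ a ≤ a * 2 ^ b + 1
2^a≤a*2^b+1 zero    b _         = ≤-refl
2^a≤a*2^b+1 (suc a) b (s≤s a≤b) = begin
  2 ^ suc a                ≡⟨ cong (2 ^ a +_) (+-identityʳ (2 ^ a)) ⟩
  2 ^ a + 2 ^ a            ≤⟨ +-mono-≤ (^-monoʳ-≤ 2 a≤b) (2^a≤a*2^b+1 a b (m≤n⇒m≤1+n a≤b)) ⟩
  2 ^ b + (a * 2 ^ b + 1)  ≡⟨ +-assoc (2 ^ b) (a * 2 ^ b) 1 ⟨
  suc a * 2 ^ b + 1        ∎
  where open ≤-Reasoning

classBound-step : ∀ a b t → a ≤ suc b → a * 2 ^ (t + b) + 2 ^ (a + t) ≤ a * 2 ^ (t + suc b) + 2 ^ t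
classBound-step a b t a≤1+b = begin
  a * 2 ^ (t + b) + 2 ^ (a + t)        ≡⟨ cong₂ (λ x y → a * x + y) (^-distribˡ-+-* 2 t b) (^-distribˡ-+-* 2 a t) ⟩
  a * (2ᵗ * 2ᵇ) + 2ᵃ * 2ᵗ              ≡⟨ solve 4 (λ a t e p → a :* (t :* e) :+ p :* t := t :* (a :* e :+ p)) refl a 2ᵗ 2ᵇ 2ᵃ ⟩
  2ᵗ * (a * 2ᵇ + 2ᵃ)                   ≤⟨ *-monoʳ-≤ 2ᵗ (+-monoʳ-≤ (a * 2ᵇ) (2^a≤a*2^b+1 a b a≤1+b)) ⟩
  2ᵗ * (a * 2ᵇ + (a * 2ᵇ + 1))         ≡⟨ solve 3 (λ a t e → t :* (a :* e :+ (a :* e :+ con 1)) := a :* (t :* (con 2 :* e)) :+ t) refl a 2ᵗ 2ᵇ ⟩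
  a * (2ᵗ * 2 ^ suc b) + 2ᵗ            ≡⟨ cong (λ x → a * x + 2ᵗ) (^-distribˡ-+-* 2 t (suc b)) ⟨
  a * 2 ^ (t + suc b) + 2 ^ t          ∎
  where
  open ≤-Reasoning
  open +-*-Solver
  2ᵗ = 2 ^ t
  2ᵇ = 2 ^ b
  2ᵃ = 2 ^ a

classBound-decrement : ∀ r {c c′ : Fin r → ℕ} q T → DecrementedAt q c c′ →
                       (∀ j → toℕ j < toℕ q → c j ≤ c q) → sum c ≡ T + c q →
                       classBound r c′ + 2 ^ T ≤ classBound r c
classBound-decrement (suc r) {c} {c′} zero T (c₀ , rest) _ total = ≤-reflexive (begin
  c′ zero * 2 ^ sum (c′ ∘ suc) + R′ + 2 ^ T  ≡⟨ cong₂ (λ s R → c′ zero * 2 ^ s + R + 2 ^ T) S′≡T (classBound-cong r tail≗) ⟩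
  c′ zero * 2 ^ T + R + 2 ^ T              ≡⟨ solve 3 (λ x t R → x :* t :+ R :+ t := (con 1 :+ x) :* t :+ R) refl (c′ zero) (2 ^ T) R ⟩
  suc (c′ zero) * 2 ^ T + R                ≡⟨ cong₂ (λ x s → x * 2 ^ s + R) c₀ S≡T ⟨
  c zero * 2 ^ sum (c ∘ suc) + R           ∎)
  where
  open ≡-Reasoning
  open +-*-Solver
  R = classBound r (c ∘ suc)
  R′ = classBound r (c′ ∘ suc)
  tail≗ : c′ ∘ suc ≗ c ∘ suc
  tail≗ j = rest (suc j) λ ()
  S≡T : sum (c ∘ suc) ≡ T
  S≡T = +-cancelˡ-≡ (c zero) _ _ (trans total (+-comm T (c zero)))
  S′≡T : sum (c′ ∘ suc) ≡ T
  S′≡T = trans (sum-cong-≗ tail≗) S≡T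
classBound-decrement (suc r) {c} {c′} (suc q) T dec sorted total = begin
  c′ zero * 2 ^ sum (c′ ∘ suc) + R′ + 2 ^ T   ≡⟨ cong₂ (λ x s → x * 2 ^ s + R′ + 2 ^ T) c′₀≡a S′≡ ⟩
  a * 2 ^ (T′ + b) + R′ + 2 ^ T               ≡⟨ cong (λ t → a * 2 ^ (T′ + b) + R′ + 2 ^ t) T≡ ⟩
  a * 2 ^ (T′ + b) + R′ + 2 ^ (a + T′)        ≡⟨ xy∙z≈xz∙y (a * 2 ^ (T′ + b)) R′ (2 ^ (a + T′)) ⟩
  a * 2 ^ (T′ + b) + 2 ^ (a + T′) + R′        ≤⟨ +-monoˡ-≤ R′ (classBound-step a b T′ a≤1+b) ⟩
  a * 2 ^ (T′ + suc b) + 2 ^ T′ + R′          ≡⟨ xy∙z≈x∙zy (a * 2 ^ (T′ + suc b)) (2 ^ T′) R′ ⟩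
  a * 2 ^ (T′ + suc b) + (R′ + 2 ^ T′)        ≤⟨ +-monoʳ-≤ (a * 2 ^ (T′ + suc b)) ih ⟩
  a * 2 ^ (T′ + suc b) + R                    ≡⟨ cong (λ s → a * 2 ^ s + R) S≡ ⟨
  a * 2 ^ sum (c ∘ suc) + R                   ∎
  where
  open ≤-Reasoning
  a = c zero
  b = c′ (suc q)
  R = classBound r (c ∘ suc)
  R′ = classBound r (c′ ∘ suc)
  c′₀≡a : c′ zero ≡ a
  c′₀≡a = proj₂ dec zero λ ()
  a≤1+b : a ≤ suc b
  a≤1+b = subst (a ≤_) (proj₁ dec) (sorted zero (s≤s z≤n))
  T′ = sum (c ∘ suc) ∸ c (suc q)
  S≡T′+cq : sum (c ∘ suc) ≡ T′ + c (suc q)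
  S≡T′+cq = sym (m∸n+n≡m (subst (c (suc q) ≤_) (sym (sum-pick (c ∘ suc) q)) (m≤m+n _ _)))
  S≡ : sum (c ∘ suc) ≡ T′ + suc b
  S≡ = trans S≡T′+cq (cong (T′ +_) (proj₁ dec))
  S′≡ : sum (c′ ∘ suc) ≡ T′ + b
  S′≡ = suc-injective (trans (sym (sum-decrement (DecrementedAt-tail dec))) (trans S≡ (+-suc T′ b)))
  T≡ : T ≡ a + T′
  T≡ = +-cancelʳ-≡ (c (suc q)) T (a + T′) (sym (trans (+-assoc a T′ _) (trans (cong (a +_) (sym S≡T′+cq)) total)))
  ih : R′ + 2 ^ T′ ≤ R
  ih = classBound-decrement r q T′ (DecrementedAt-tail dec) (λ j j<q → sorted (suc j) (s≤s j<q)) S≡T′+cq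

SortedOnSupport : ∀ {r} → (Fin r → ℕ) → Set
SortedOnSupport c = ∀ j l → toℕ j < toℕ l → 0 < c l → c j ≤ c l

SortedOnSupport-decrement : ∀ {r q} {c c′ : Fin r → ℕ} → SortedOnSupport c → DecrementedAt q c c′ →
                            (∀ j → toℕ j < toℕ q → c j ≢ c q) → SortedOnSupport c′
SortedOnSupport-decrement {q = q} {c} {c′} sorted (cq , rest) first j l j<l 0<c′l with j ≟ q | l ≟ q
... | yes refl | yes refl = contradiction j<l (<-irrefl refl)
... | yes refl | no l≢q   = begin
  c′ q        ≤⟨ n≤1+n (c′ q) ⟩
  suc (c′ q)  ≡⟨ cq ⟨
  c q         ≤⟨ sorted q l j<l (subst (0 <_) (rest l l≢q) 0<c′l) ⟩
  c l         ≡⟨ rest l l≢q ⟨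
  c′ l        ∎
  where open ≤-Reasoning
... | no j≢q   | yes refl = begin
  c′ j  ≡⟨ rest j j≢q ⟩
  c j   ≤⟨ s≤s⁻¹ (subst (c j <_) cq (≤∧≢⇒< cj≤cq (first j j<l))) ⟩
  c′ q  ∎
  where
  open ≤-Reasoning
  cj≤cq : c j ≤ c q
  cj≤cq = sorted j q j<l (subst (0 <_) (sym cq) (s≤s z≤n))
... | no j≢q   | no l≢q   = subst₂ _≤_ (sym (rest j j≢q)) (sym (rest l l≢q))
                              (sorted j l j<l (subst (0 <_) (rest l l≢q) 0<c′l))

transpose-ˡ : ∀ {r} (i j : Fin r) → PC.transpose i j i ≡ j
transpose-ˡ i j rewrite dec-true (i ≟ i) refl = refl

transpose-ʳ : ∀ {r} (i j : Fin r) → PC.transpose i j j ≡ i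
transpose-ʳ i j with j ≟ i
... | yes j≡i = j≡i
... | no  _   rewrite dec-true (j ≟ j) refl = refl

transpose-fix : ∀ {r} (i j k : Fin r) → k ≢ i → k ≢ j → PC.transpose i j k ≡ k
transpose-fix i j k k≢i k≢j rewrite dec-false (k ≟ i) k≢i | dec-false (k ≟ j) k≢j = refl

DecrementedAt-transpose : ∀ {r p q} {c d : Fin r → ℕ} → DecrementedAt p c d → c p ≡ c q →
                          DecrementedAt q c (d ∘ PC.transpose q p)
DecrementedAt-transpose {p = p} {q} {c} {d} (cp , rest) cp≡cq =
  trans (sym cp≡cq) (trans cp (cong (suc ∘ d) (sym (transpose-ˡ q p)))) , rest′
  where
  rest′ : ∀ j → j ≢ q → d (PC.transpose q p j) ≡ c j
  rest′ j j≢q with j ≟ p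
  ... | yes refl = trans (cong d (transpose-ʳ q p)) (trans (rest q (j≢q ∘ sym)) (sym cp≡cq))
  ... | no  j≢p  = trans (cong d (transpose-fix q p j j≢q j≢p)) (rest j j≢p)

1+n≤2^n : ∀ n → suc n ≤ 2 ^ n
1+n≤2^n zero    = ≤-refl
1+n≤2^n (suc n) = begin
  1 + suc n          ≤⟨ +-mono-≤ (m^n>0 2 n) (1+n≤2^n n) ⟩
  2 ^ n + 2 ^ n      ≡⟨ cong (2 ^ n +_) (+-identityʳ (2 ^ n)) ⟨
  2 ^ suc n          ∎
  where open ≤-Reasoning

2^d+k≤2^t : ∀ d i k t → 2 * k ≤ i * 2 ^ d → d + i ≤ t → 2 ^ d + k ≤ 2 ^ t
2^d+k≤2^t d i k t 2k≤i2ᵈ d+i≤t = *-cancelˡ-≤ 2 (begin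
  2 * (2 ^ d + k)           ≡⟨ *-distribˡ-+ 2 (2 ^ d) k ⟩
  2 * 2 ^ d + 2 * k         ≤⟨ +-monoʳ-≤ (2 * 2 ^ d) 2k≤i2ᵈ ⟩
  2 * 2 ^ d + i * 2 ^ d     ≡⟨ *-distribʳ-+ (2 ^ d) 2 i ⟨
  (2 + i) * 2 ^ d           ≤⟨ *-monoˡ-≤ (2 ^ d) (1+n≤2^n (suc i)) ⟩
  2 ^ suc i * 2 ^ d         ≡⟨ ^-distribˡ-+-* 2 (suc i) d ⟨
  2 ^ (suc i + d)           ≤⟨ ^-monoʳ-≤ 2 (s≤s (subst (_≤ t) (+-comm d i) d+i≤t)) ⟩
  2 ^ suc t                 ∎)
  where open ≤-Reasoning

-- Oriented multipartite graphs

classSize : ∀ {m r} → (Fin m → Bool) → (Fin m → Fin r) → Fin r → ℕ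
classSize W cls j = ∑∈ W (λ u → 𝟙[ does (cls u ≟ j) ])

sum-𝟙[≟] : ∀ {r} (p : Fin r) → ∑[ j < r ] 𝟙[ does (p ≟ j) ] ≡ 1
sum-𝟙[≟] {suc r} zero    = cong suc (sum-replicate-zero r)
sum-𝟙[≟] {suc r} (suc p) = sum-𝟙[≟] p

sum-classSize : ∀ {m r} W (cls : Fin m → Fin r) → sum (classSize W cls) ≡ size W
sum-classSize {m} {r} W cls =
  trans (sym (∑-comm {m} {r} (λ u j → if W u then 𝟙[ does (cls u ≟ j) ] else 0))) (sum-cong-≗ pointwise)
  where
  pointwise : ∀ u → ∑[ j < r ] (if W u then 𝟙[ does (cls u ≟ j) ] else 0) ≡ (if W u then 1 else 0)
  pointwise u with W u
  ... | true  = sum-𝟙[≟] (cls u)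
  ... | false = sum-replicate-zero r

classSize-permute : ∀ {m r} W (cls : Fin m → Fin r) (π : Permutation r r) j →
                    classSize W ((π ⟨$⟩ʳ_) ∘ cls) j ≡ classSize W cls (π ⟨$⟩ˡ j)
classSize-permute W cls π j = ∑∈-cong W λ u _ → cong 𝟙[_] (does-⇔ (mk⇔
  (λ πc≡j → trans (sym (Perm.inverseˡ π {cls u})) (cong (π ⟨$⟩ˡ_) πc≡j))
  (λ c≡π⁻¹j → trans (cong (π ⟨$⟩ʳ_) c≡π⁻¹j) (Perm.inverseʳ π {j}))) (π ⟨$⟩ʳ cls u ≟ j) (cls u ≟ π ⟨$⟩ˡ j))

classSize-remove : ∀ {m r} W (cls : Fin m → Fin r) x → W x ≡ true →
                   DecrementedAt (cls x) (classSize W cls) (classSize (W ─ x) cls)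
classSize-remove W cls x wx = here , elsewhere
  where
  here : classSize W cls (cls x) ≡ suc (classSize (W ─ x) cls (cls x))
  here = trans (∑∈-remove W _ x wx) (cong (λ b → 𝟙[ b ] + classSize (W ─ x) cls (cls x)) (dec-true (cls x ≟ cls x) refl))
  elsewhere : ∀ j → j ≢ cls x → classSize (W ─ x) cls j ≡ classSize W cls j
  elsewhere j j≢p = sym (trans (∑∈-remove W _ x wx) (cong (λ b → 𝟙[ b ] + classSize (W ─ x) cls j) (dec-false (cls x ≟ j) (j≢p ∘ sym))))

classSize-remove-transpose : ∀ {m r} W (cls : Fin m → Fin r) x q → W x ≡ true →
                             classSize W cls q ≡ classSize W cls (cls x) →
                             DecrementedAt q (classSize W cls) (classSize (W ─ x) ((Perm.transpose (cls x) q ⟨$⟩ʳ_) ∘ cls))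
classSize-remove-transpose W cls x q wx cq≡cp =
  DecrementedAt-resp-≗ (classSize-permute (W ─ x) cls (Perm.transpose (cls x) q))
                       (DecrementedAt-transpose (classSize-remove W cls x wx) (sym cq≡cp))

2^[𝟙+d] : ∀ a d → 2 ^ (𝟙[ a ] + d) ≡ 2 ^ d + 𝟙[ a ] * 2 ^ d
2^[𝟙+d] true  d = refl
2^[𝟙+d] false d = sym (+-identityʳ (2 ^ d))

module OrientedGraph {m : ℕ} (arc : Fin m → Fin m → Bool) where

  outdeg : (Fin m → Bool) → Fin m → ℕ
  outdeg W u = ∑∈ W (λ w → 𝟙[ arc u w ])

  indeg : (Fin m → Bool) → Fin m → ℕ
  indeg W x = ∑∈ W (λ u → 𝟙[ arc u x ])

  ∑2^outdeg : (Fin m → Bool) → ℕ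
  ∑2^outdeg W = ∑∈ W (λ u → 2 ^ outdeg W u)

  ∑2^outdeg-into : (Fin m → Bool) → Fin m → ℕ
  ∑2^outdeg-into W x = ∑∈ W (λ u → 𝟙[ arc u x ] * 2 ^ outdeg W u)

  Asymmetric : (Fin m → Bool) → Set
  Asymmetric W = ∀ u w → W u ≡ true → W w ≡ true → arc u w ≡ true → arc w u ≡ false

  Multipartite : ∀ {r} → (Fin m → Bool) → (Fin m → Fin r) → Set
  Multipartite W cls = ∀ u w → W u ≡ true → W w ≡ true → arc u w ≡ true → cls u ≢ cls w

  Asymmetric-remove : ∀ {W} x → Asymmetric W → Asymmetric (W ─ x)
  Asymmetric-remove {W} x asym u w u∈ w∈ = asym u w (∈─⇒∈ W x u∈) (∈─⇒∈ W x w∈)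

  Multipartite-remove : ∀ {r W} {cls : Fin m → Fin r} x → Multipartite W cls → Multipartite (W ─ x) cls
  Multipartite-remove {W = W} x mp u w u∈ w∈ = mp u w (∈─⇒∈ W x u∈) (∈─⇒∈ W x w∈)

  Multipartite-permute : ∀ {r W} {cls : Fin m → Fin r} (π : Permutation r r) →
                         Multipartite W cls → Multipartite W ((π ⟨$⟩ʳ_) ∘ cls)
  Multipartite-permute π mp u w u∈ w∈ u→w πcu≡πcw = mp u w u∈ w∈ u→w
    (trans (sym (Perm.inverseˡ π)) (trans (cong (π ⟨$⟩ˡ_) πcu≡πcw) (Perm.inverseˡ π)))

  outdeg-remove : ∀ W x u → W x ≡ true → outdeg W u ≡ 𝟙[ arc u x ] + outdeg (W ─ x) u
  outdeg-remove W x u = ∑∈-remove W (λ w → 𝟙[ arc u w ]) x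

  ∑2^outdeg-remove : ∀ W x → W x ≡ true →
                     ∑2^outdeg W ≡ 2 ^ outdeg W x + (∑2^outdeg (W ─ x) + ∑2^outdeg-into (W ─ x) x)
  ∑2^outdeg-remove W x wx = trans (∑∈-remove W _ x wx) (cong (2 ^ outdeg W x +_) (begin
    ∑∈ (W ─ x) (λ u → 2 ^ outdeg W u)
      ≡⟨ ∑∈-cong (W ─ x) (λ u _ → trans (cong (2 ^_) (outdeg-remove W x u wx)) (2^[𝟙+d] (arc u x) _)) ⟩
    ∑∈ (W ─ x) (λ u → 2 ^ outdeg (W ─ x) u + 𝟙[ arc u x ] * 2 ^ outdeg (W ─ x) u)
      ≡⟨ ∑∈-distrib-+ (W ─ x) _ _ ⟩
    ∑2^outdeg (W ─ x) + ∑2^outdeg-into (W ─ x) x ∎))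
    where open ≡-Reasoning

  indeg-remove-≤ : ∀ W x → W x ≡ true → indeg (W ─ x) x ≤ indeg W x
  indeg-remove-≤ W x wx = subst (indeg (W ─ x) x ≤_) (sym (∑∈-remove W _ x wx)) (m≤n+m _ _)

  -- An in-neighbour u of x has 2 * 2 ^ outdeg (W ─ x) u = 2 ^ outdeg W u ≤ 2 ^ outdeg W x.
  ∑2^outdeg-into-bound : ∀ W x → W x ≡ true → (∀ u → W u ≡ true → outdeg W u ≤ outdeg W x) →
                         2 * ∑2^outdeg-into (W ─ x) x ≤ indeg (W ─ x) x * 2 ^ outdeg W x
  ∑2^outdeg-into-bound W x wx x-max = begin
    2 * ∑2^outdeg-into (W ─ x) x                                   ≡⟨ *-distribˡ-∑∈ (W ─ x) 2 _ ⟩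
    ∑∈ (W ─ x) (λ u → 2 * (𝟙[ arc u x ] * 2 ^ outdeg (W ─ x) u))  ≤⟨ ∑∈-mono-≤ (W ─ x) pointwise ⟩
    ∑∈ (W ─ x) (λ u → 2 ^ D * 𝟙[ arc u x ])                        ≡⟨ *-distribˡ-∑∈ (W ─ x) (2 ^ D) _ ⟨
    2 ^ D * indeg (W ─ x) x                                        ≡⟨ *-comm (2 ^ D) _ ⟩
    indeg (W ─ x) x * 2 ^ D                                        ∎
    where
    open ≤-Reasoning
    D = outdeg W x
    pointwise : ∀ u → (W ─ x) u ≡ true → 2 * (𝟙[ arc u x ] * 2 ^ outdeg (W ─ x) u) ≤ 2 ^ D * 𝟙[ arc u x ]
    pointwise u u∈ with arc u x in u→x
    ... | false = z≤n
    ... | true  = begin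
      2 * (1 * 2 ^ outdeg (W ─ x) u)         ≡⟨ cong (2 *_) (*-identityˡ (2 ^ outdeg (W ─ x) u)) ⟩
      2 ^ (1 + outdeg (W ─ x) u)             ≡⟨ cong (λ b → 2 ^ (𝟙[ b ] + outdeg (W ─ x) u)) u→x ⟨
      2 ^ (𝟙[ arc u x ] + outdeg (W ─ x) u)  ≡⟨ cong (2 ^_) (outdeg-remove W x u wx) ⟨
      2 ^ outdeg W u                         ≤⟨ ^-monoʳ-≤ 2 (x-max u (∈─⇒∈ W x u∈)) ⟩
      2 ^ D                                  ≡⟨ *-identityʳ (2 ^ D) ⟨
      2 ^ D * 1                              ∎

  -- Out-neighbours, in-neighbours and class-mates of x are three disjoint sets.
  outdeg+indeg+classSize≤size : ∀ {r} W (cls : Fin m → Fin r) x → Asymmetric W → Multipartite W cls →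
                                W x ≡ true → outdeg W x + indeg W x + classSize W cls (cls x) ≤ size W
  outdeg+indeg+classSize≤size W cls x asym mp wx = begin
    outdeg W x + indeg W x + classSize W cls (cls x)
      ≡⟨ cong (_+ classSize W cls (cls x)) (∑∈-distrib-+ W _ _) ⟨
    ∑∈ W (λ w → 𝟙[ arc x w ] + 𝟙[ arc w x ]) + classSize W cls (cls x)
      ≡⟨ ∑∈-distrib-+ W _ _ ⟨
    ∑∈ W (λ w → 𝟙[ arc x w ] + 𝟙[ arc w x ] + 𝟙[ does (cls w ≟ cls x) ])
      ≤⟨ ∑∈-mono-≤ W at-most-one ⟩
    size W ∎
    where
    open ≤-Reasoning
    at-most-one : ∀ w → W w ≡ true → 𝟙[ arc x w ] + 𝟙[ arc w x ] + 𝟙[ does (cls w ≟ cls x) ] ≤ 1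
    at-most-one w w∈ with arc x w in x→w | arc w x in w→x | cls w ≟ cls x
    ... | true  | true  | _     = contradiction (trans (sym w→x) (asym x w wx w∈ x→w)) λ ()
    ... | true  | false | yes e = contradiction (sym e) (mp x w wx w∈ x→w)
    ... | true  | false | no  _ = ≤-refl
    ... | false | true  | yes e = contradiction e (mp w x w∈ wx w→x)
    ... | false | true  | no  _ = ≤-refl
    ... | false | false | yes _ = ≤-refl
    ... | false | false | no  _ = z≤n

  Bounded : (Fin m → Bool) → Set
  Bounded W = ∀ {r} (cls : Fin m → Fin r) → Asymmetric W → Multipartite W cls →
              SortedOnSupport (classSize W cls) → ∑2^outdeg W ≤ classBound r (classSize W cls)

  -- Remove a vertex x of maximum out-degree, and relabel classes so that its class becomes
  -- the first one of that size, which keeps the class sizes sorted.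
  Bounded-remove : ∀ W x → W x ≡ true → (∀ u → W u ≡ true → outdeg W u ≤ outdeg W x) →
                   Bounded (W ─ x) → Bounded W
  Bounded-remove W x wx x-max ih {r} cls asym mp sorted = begin
    ∑2^outdeg W                          ≡⟨ ∑2^outdeg-remove W x wx ⟩
    2 ^ D + (∑2^outdeg (W ─ x) + K)      ≡⟨ x∙yz≈y∙xz (2 ^ D) _ K ⟩
    ∑2^outdeg (W ─ x) + (2 ^ D + K)      ≤⟨ +-mono-≤ ih′ (2^d+k≤2^t D i K T (∑2^outdeg-into-bound W x wx x-max) D+i≤T) ⟩
    classBound r c′ + 2 ^ T              ≤⟨ classBound-decrement r q T dec below-q total ⟩
    classBound r c                       ∎
    where
    open ≤-Reasoning
    c = classSize W cls
    p = cls x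
    D = outdeg W x
    i = indeg (W ─ x) x
    K = ∑2^outdeg-into (W ─ x) x
    least = least-witness (λ j → c j ≟ℕ c p) p refl
    q = proj₁ least
    cq≡cp : c q ≡ c p
    cq≡cp = proj₁ (proj₂ least)
    π = Perm.transpose p q
    cls′ = (π ⟨$⟩ʳ_) ∘ cls
    c′ = classSize (W ─ x) cls′
    dec : DecrementedAt q c c′
    dec = classSize-remove-transpose W cls x q wx cq≡cp
    below-q : ∀ j → toℕ j < toℕ q → c j ≤ c q
    below-q j j<q = sorted j q j<q (subst (0 <_) (sym (proj₁ dec)) (s≤s z≤n))
    ih′ : ∑2^outdeg (W ─ x) ≤ classBound r c′
    ih′ = ih cls′ (Asymmetric-remove x asym) (Multipartite-permute π (Multipartite-remove x mp))
             (SortedOnSupport-decrement sorted dec λ j j<q cj≡cq → proj₂ (proj₂ least) j j<q (trans cj≡cq cq≡cp))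
    T = size W ∸ c q
    total : sum c ≡ T + c q
    total = trans (sum-classSize W cls) (sym (m∸n+n≡m (subst (c q ≤_) (sum-classSize W cls)
              (subst (c q ≤_) (sym (sum-pick c q)) (m≤m+n _ _)))))
    D+i≤T : D + i ≤ T
    D+i≤T = m+n≤o⇒m≤o∸n (D + i) (begin
      D + i + c q             ≤⟨ +-monoˡ-≤ (c q) (+-monoʳ-≤ D (indeg-remove-≤ W x wx)) ⟩
      D + indeg W x + c q     ≡⟨ cong (D + indeg W x +_) cq≡cp ⟩
      D + indeg W x + c p     ≤⟨ outdeg+indeg+classSize≤size W cls x asym mp wx ⟩
      size W                  ∎)

  bounded : ∀ n W → size W ≡ n → Bounded W
  bounded n W |W|≡n with argmax W (outdeg W)
  ... | inj₁ empty = λ cls _ _ _ → subst (_≤ _) (sym (∑∈-none W _ empty)) z≤n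
  bounded zero    W |W|≡0 | inj₂ (x , wx , _) =
    contradiction (trans (sym (∑∈-remove W (const 1) x wx)) |W|≡0) λ ()
  bounded (suc n) W |W|≡1+n | inj₂ (x , wx , x-max) =
    Bounded-remove W x wx x-max (bounded n (W ─ x) |W─x|≡n)
    where
    |W─x|≡n : size (W ─ x) ≡ n
    |W─x|≡n = suc-injective (trans (sym (∑∈-remove W (const 1) x wx)) |W|≡1+n)

-- Closed sets

⊈⇒∃∈∉ : ∀ {n} {S T : Subset n} → ¬ (S ⊆ T) → ∃ λ x → x ∈ S × x ∉ T
⊈⇒∃∈∉ {S = S} {T} S⊈T with any? (λ x → (x ∈? S) ×-dec ¬? (x ∈? T))
... | yes witness = witness
... | no  none    = contradiction (λ {x} x∈S → decidable-stable (x ∈? T) (λ x∉T → none (x , x∈S , x∉T))) S⊈T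

module ClosedSets {m : ℕ} (G : TCM m) where
  open TCM G

  omit-reverse : ∀ x y z → x ≢ y → y ≢ z → x ≢ z → omit x y z ≡ omit z y x
  omit-reverse x y z x≢y y≢z x≢z = begin
    omit x y z  ≡⟨ omit-swap₁₂ x y z x≢y y≢z x≢z ⟩
    omit y x z  ≡⟨ omit-swap₂₃ y x z (x≢y ∘ sym) x≢z y≢z ⟩
    omit y z x  ≡⟨ omit-swap₁₂ z y x (y≢z ∘ sym) (x≢y ∘ sym) (x≢z ∘ sym) ⟨
    omit z y x  ∎
    where open ≡-Reasoning

  omit-rotate : ∀ x y z → x ≢ y → y ≢ z → x ≢ z → omit x y z ≡ omit y z x
  omit-rotate x y z x≢y y≢z x≢z = trans (omit-swap₁₂ x y z x≢y y≢z x≢z) (omit-swap₂₃ y x z (x≢y ∘ sym) x≢z y≢z)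

  closed? : (S : Subset m) → Dec (Closed G S)
  closed? S = all? λ x → all? λ y → all? λ z →
    (x ∈? S) →-dec (y ∈? S) →-dec ¬? (x ≟ y) →-dec ¬? (z ∈? S) →-dec (omit x y z ≟ z)

  -- If x ∈ S ∖ T and y ∈ T ∖ S, then in the triangle x z y closedness of S chooses xz
  -- while closedness of T chooses yz.
  closed-nested : ∀ {S T} z → Closed G S → Closed G T → z ∈ S → z ∈ T → S ⊆ T ⊎ T ⊆ S
  closed-nested {S} {T} z closedS closedT z∈S z∈T with S ⊆? T | T ⊆? S
  ... | yes S⊆T | _       = inj₁ S⊆T
  ... | no  _   | yes T⊆S = inj₂ T⊆S
  ... | no  S⊈T | no  T⊈S with ⊈⇒∃∈∉ S⊈T | ⊈⇒∃∈∉ T⊈S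
  ...   | x , x∈S , x∉T | y , y∈T , y∉S = contradiction (subst (_∈ S) x≡y x∈S) y∉S
    where
    x≢z : x ≢ z
    x≢z x≡z = x∉T (subst (_∈ T) (sym x≡z) z∈T)
    z≢y : z ≢ y
    z≢y z≡y = y∉S (subst (_∈ S) z≡y z∈S)
    x≢y : x ≢ y
    x≢y x≡y = y∉S (subst (_∈ S) x≡y x∈S)
    x≡y : x ≡ y
    x≡y = begin
      x           ≡⟨ closedT y z x y∈T z∈T (z≢y ∘ sym) x∉T ⟨
      omit y z x  ≡⟨ omit-reverse x z y x≢z z≢y x≢y ⟨
      omit x z y  ≡⟨ closedS x z y x∈S z∈S x≢z y∉S ⟩
      y           ∎
      where open ≡-Reasoning

  maximal-disjoint : ∀ {S T} x → MaximalClosed G S → MaximalClosed G T → S ≢ T → x ∈ S → x ∉ T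
  maximal-disjoint x (closedS , S≢⊤ , maxS) (closedT , T≢⊤ , maxT) S≢T x∈S x∈T
    with closed-nested x closedS closedT x∈S x∈T
  ... | inj₁ S⊆T = S≢T (sym (maxS _ closedT T≢⊤ S⊆T))
  ... | inj₂ T⊆S = S≢T (maxT _ closedS S≢⊤ T⊆S)

  -- n bounds the number of elements still missing from S.
  extend-to-maximal : ∀ n S → m ≤ ∣ S ∣ + n → Closed G S → S ≢ ⊤ → ∃ λ M → MaximalClosed G M × S ⊆ M
  extend-to-maximal zero S m≤∣S∣ _ S≢⊤ =
    contradiction (∣p∣≡n⇒p≡⊤ (≤-antisym (∣p∣≤n S) (subst (m ≤_) (+-identityʳ _) m≤∣S∣))) S≢⊤
  extend-to-maximal (suc n) S m≤∣S∣+1+n closedS S≢⊤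
    with anySubset? (λ T → closed? T ×-dec ¬? (≡-dec _≟ᴮ_ T ⊤) ×-dec (S ⊂? T))
  ... | yes (T , closedT , T≢⊤ , S⊂T) =
    let (M , maxM , T⊆M) = extend-to-maximal n T m≤∣T∣+n closedT T≢⊤ in M , maxM , λ x∈S → T⊆M (proj₁ S⊂T x∈S)
    where
    m≤∣T∣+n : m ≤ ∣ T ∣ + n
    m≤∣T∣+n = ≤-trans m≤∣S∣+1+n (subst (_≤ ∣ T ∣ + n) (sym (+-suc ∣ S ∣ n)) (+-monoˡ-≤ n (p⊂q⇒∣p∣<∣q∣ S⊂T)))
  ... | no  none = S , (closedS , S≢⊤ , maximal) , λ x∈S → x∈S
    where
    maximal : ∀ T → Closed G T → T ≢ ⊤ → S ⊆ T → T ≡ S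
    maximal T closedT T≢⊤ S⊆T with T ⊆? S
    ... | yes T⊆S = ⊆-antisym T⊆S S⊆T
    ... | no  T⊈S = contradiction (T , closedT , T≢⊤ , (λ {x} → S⊆T {x}) , ⊈⇒∃∈∉ T⊈S) none

  in-maximal : ∀ u v → u ≢ v → ∃ λ M → MaximalClosed G M × u ∈ M
  in-maximal u v u≢v with extend-to-maximal m ⁅ u ⁆ (m≤n+m m _) closed-⁅u⁆ ⁅u⁆≢⊤
    where
    closed-⁅u⁆ : Closed G ⁅ u ⁆
    closed-⁅u⁆ x y z x∈ y∈ x≢y _ = contradiction (trans (x∈⁅y⁆⇒x≡y u x∈) (sym (x∈⁅y⁆⇒x≡y u y∈))) x≢y
    ⁅u⁆≢⊤ : ⁅ u ⁆ ≢ ⊤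
    ⁅u⁆≢⊤ ⁅u⁆≡⊤ = u≢v (sym (x∈⁅y⁆⇒x≡y u (subst (v ∈_) (sym ⁅u⁆≡⊤) ∈⊤)))
  ... | M , maxM , ⁅u⁆⊆M = M , maxM , ⁅u⁆⊆M (x∈⁅x⁆ u)

-- The vertices outside A i

module Outside {m} (G : TCM m) {k} (A : Fin k → Subset m)
               (maximal : ∀ j → MaximalClosed G (A j))
               (complete : ∀ S → MaximalClosed G S → ∃ λ j → A j ≡ S)
               (distinct : ∀ j j′ → A j ≡ A j′ → j ≡ j′)
               (i : Fin k) (v : Fin m) (v∈Aᵢ : v ∈ A i) where
  open TCM G
  open ClosedSets G

  W : Fin m → Bool
  W u = not (does (u ∈? A i))

  ∈W⇒∉Aᵢ : ∀ {u} → W u ≡ true → u ∉ A i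
  ∈W⇒∉Aᵢ {u} u∈W u∈Aᵢ rewrite dec-true (u ∈? A i) u∈Aᵢ = contradiction u∈W λ ()

  ∉Aᵢ⇒∈W : ∀ {u} → u ∉ A i → W u ≡ true
  ∉Aᵢ⇒∈W {u} u∉Aᵢ rewrite dec-false (u ∈? A i) u∉Aᵢ = refl

  ∉Aᵢ⇒≢v : ∀ {u} → u ∉ A i → u ≢ v
  ∉Aᵢ⇒≢v u∉Aᵢ refl = u∉Aᵢ v∈Aᵢ

  disjoint : ∀ {j j′} u → j ≢ j′ → u ∈ A j → u ∉ A j′
  disjoint u j≢j′ = maximal-disjoint u (maximal _) (maximal _) (j≢j′ ∘ distinct _ _)

  class : Fin m → Fin k
  class u with any? (λ j → u ∈? A j)
  ... | yes (j , _) = j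
  ... | no  _       = i

  class-∈ : ∀ u → u ∉ A i → u ∈ A (class u)
  class-∈ u u∉Aᵢ with any? (λ j → u ∈? A j)
  ... | yes (j , u∈Aⱼ) = u∈Aⱼ
  ... | no  none       =
    let (M , maxM , u∈M) = in-maximal u v (∉Aᵢ⇒≢v u∉Aᵢ)
        (j , Aⱼ≡M)       = complete M maxM
    in contradiction (j , subst (u ∈_) (sym Aⱼ≡M) u∈M) none

  class-unique : ∀ {u j} → u ∉ A i → u ∈ A j → class u ≡ j
  class-unique {u} {j} u∉Aᵢ u∈Aⱼ with class u ≟ j
  ... | yes c≡j = c≡j
  ... | no  c≢j = contradiction u∈Aⱼ (disjoint u c≢j (class-∈ u u∉Aᵢ))

  class≢i : ∀ {u} → u ∉ A i → class u ≢ i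
  class≢i {u} u∉Aᵢ c≡i = u∉Aᵢ (subst (λ j → u ∈ A j) c≡i (class-∈ u u∉Aᵢ))

  arc : Fin m → Fin m → Bool
  arc u w = does (omit u v w ≟ w) ∧ not (does (w ≟ u))

  arc⇒ : ∀ {u w} → arc u w ≡ true → omit u v w ≡ w × w ≢ u
  arc⇒ {u} {w} u→w with omit u v w ≟ w | w ≟ u
  ... | yes chosen | no w≢u = chosen , w≢u
  ... | yes _      | yes _  = contradiction u→w λ ()
  ... | no  _      | _      = contradiction u→w λ ()

  open OrientedGraph arc

  asymmetric : Asymmetric W
  asymmetric u w u∈W w∈W u→w with arc w u in w→u
  ... | false = refl
  ... | true  = contradiction (begin
    w           ≡⟨ proj₁ (arc⇒ u→w) ⟨
    omit u v w  ≡⟨ omit-reverse u v w (∉Aᵢ⇒≢v (∈W⇒∉Aᵢ u∈W)) (∉Aᵢ⇒≢v (∈W⇒∉Aᵢ w∈W) ∘ sym) (w≢u ∘ sym) ⟩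
    omit w v u  ≡⟨ proj₁ (arc⇒ w→u) ⟩
    u           ∎) w≢u
    where
    open ≡-Reasoning
    w≢u = proj₂ (arc⇒ u→w)

  -- Inside the class A j of u and w the pair uw is chosen in uwv, since v ∉ A j.
  multipartite : Multipartite W class
  multipartite u w u∈W w∈W u→w cu≡cw = ∉Aᵢ⇒≢v w∉Aᵢ (begin
    w           ≡⟨ proj₁ (arc⇒ u→w) ⟨
    omit u v w  ≡⟨ omit-swap₂₃ u v w (∉Aᵢ⇒≢v u∉Aᵢ) (∉Aᵢ⇒≢v w∉Aᵢ ∘ sym) (proj₂ (arc⇒ u→w) ∘ sym) ⟩
    omit u w v  ≡⟨ proj₁ (maximal j) u w v (class-∈ u u∉Aᵢ) w∈Aⱼ (proj₂ (arc⇒ u→w) ∘ sym) v∉Aⱼ ⟩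
    v           ∎)
    where
    open ≡-Reasoning
    u∉Aᵢ = ∈W⇒∉Aᵢ u∈W
    w∉Aᵢ = ∈W⇒∉Aᵢ w∈W
    j = class u
    w∈Aⱼ : w ∈ A j
    w∈Aⱼ = subst (λ l → w ∈ A l) (sym cu≡cw) (class-∈ w w∉Aᵢ)
    v∉Aⱼ : v ∉ A j
    v∉Aⱼ = disjoint v (class≢i u∉Aᵢ ∘ sym) v∈Aᵢ

  -- Otherwise closedness of A i would choose vz in the triangle uvz.
  chosen⇒∉Aᵢ : ∀ {u z} → u ∉ A i → z ≢ u → z ≢ v → omit u v z ≡ z → z ∉ A i
  chosen⇒∉Aᵢ {u} {z} u∉Aᵢ z≢u z≢v chosen z∈Aᵢ = z≢u (begin
    z           ≡⟨ chosen ⟨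
    omit u v z  ≡⟨ omit-rotate u v z (∉Aᵢ⇒≢v u∉Aᵢ) (z≢v ∘ sym) (z≢u ∘ sym) ⟩
    omit v z u  ≡⟨ proj₁ (maximal i) v z u v∈Aᵢ z∈Aᵢ (z≢v ∘ sym) u∉Aᵢ ⟩
    u           ∎)
    where open ≡-Reasoning

  mult≤outdeg : ∀ u → u ∉ A i → mult G u v ≤ outdeg W u
  mult≤outdeg u u∉Aᵢ = subst (_≤ outdeg W u) (sym (length-filter-tabulate m (λ z → z) _)) (sum-mono-≤ pointwise)
    where
    pointwise : ∀ z → 𝟙[ does (¬? (z ≟ u) ×-dec (¬? (z ≟ v) ×-dec (omit u v z ≟ z))) ] ≤ (if W z then 𝟙[ arc u z ] else 0)
    pointwise z with z ≟ u | z ≟ v | omit u v z ≟ z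
    ... | yes _   | _       | _          = z≤n
    ... | no  _   | yes _   | _          = z≤n
    ... | no  _   | no  _   | no  _      = z≤n
    ... | no  z≢u | no  z≢v | yes chosen rewrite ∉Aᵢ⇒∈W (chosen⇒∉Aᵢ u∉Aᵢ z≢u z≢v chosen) = ≤-refl

  lhsSum≤∑2^outdeg : lhsSum G (A i) v ≤ ∑2^outdeg W
  lhsSum≤∑2^outdeg = subst (_≤ ∑2^outdeg W) (sym (ΣFin≡sum m _)) (sum-mono-≤ pointwise)
    where
    pointwise : ∀ u → (if does (u ∈? A i) then 0 else 2 ^ mult G u v) ≤ (if W u then 2 ^ outdeg W u else 0)
    pointwise u with u ∈? A i
    ... | yes _     = z≤n
    ... | no  u∉Aᵢ  = ^-monoʳ-≤ 2 (mult≤outdeg u u∉Aᵢ)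

  sizes : Fin k → ℕ
  sizes j = if does (j ≟ i) then 0 else ∣ A j ∣

  classSize≗sizes : classSize W class ≗ sizes
  classSize≗sizes j with j ≟ i
  ... | yes refl = trans (sum-cong-≗ pointwise) (sum-replicate-zero m)
    where
    pointwise : ∀ u → (if W u then 𝟙[ does (class u ≟ i) ] else 0) ≡ 0
    pointwise u with u ∈? A i
    ... | yes _    = refl
    ... | no  u∉Aᵢ rewrite dec-false (class u ≟ i) (class≢i u∉Aᵢ) = refl
  ... | no  j≢i  = trans (sum-cong-≗ pointwise) (size-∈ (A j))
    where
    pointwise : ∀ u → (if W u then 𝟙[ does (class u ≟ j) ] else 0) ≡ (if does (u ∈? A j) then 1 else 0)
    pointwise u with u ∈? A i | u ∈? A j
    ... | yes u∈Aᵢ | yes u∈Aⱼ = contradiction u∈Aⱼ (disjoint u (j≢i ∘ sym) u∈Aᵢ)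
    ... | yes _    | no  _    = refl
    ... | no  u∉Aᵢ | yes u∈Aⱼ rewrite dec-true (class u ≟ j) (class-unique u∉Aᵢ u∈Aⱼ) = refl
    ... | no  u∉Aᵢ | no  u∉Aⱼ
      rewrite dec-false (class u ≟ j) (λ c≡j → u∉Aⱼ (subst (λ l → u ∈ A l) c≡j (class-∈ u u∉Aᵢ))) = refl

  classSize-sorted : (∀ j j′ → toℕ j ≤ toℕ j′ → ∣ A j ∣ ≤ ∣ A j′ ∣) → SortedOnSupport (classSize W class)
  classSize-sorted sorted j l j<l 0<cₗ =
    subst₂ _≤_ (sym (classSize≗sizes j)) (sym (classSize≗sizes l)) (sizes-sorted (subst (0 <_) (classSize≗sizes l) 0<cₗ))
    where
    sizes-sorted : 0 < sizes l → sizes j ≤ sizes l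
    sizes-sorted 0<sₗ with l ≟ i | j ≟ i
    ... | yes _ | _     = contradiction 0<sₗ (<-irrefl refl)
    ... | no  _ | yes _ = z≤n
    ... | no  _ | no  _ = sorted j l (<⇒≤ j<l)

  classBound≡rhsSum : classBound k sizes ≡ rhsSum m (λ j → ∣ A j ∣) i
  classBound≡rhsSum = trans (classBound-closed k sizes) (sym (trans (ΣFin≡sum k _) (sum-cong-≗ pointwise)))
    where
    sum-sizes : sum sizes ≡ m ∸ ∣ A i ∣
    sum-sizes = trans (sym (sum-cong-≗ classSize≗sizes)) (trans (sum-classSize W class) (size-∉ (A i)))
    pointwise : ∀ j → (if does (j ≟ i) then 0 else ∣ A j ∣ * 2 ^ (m ∸ ∣ A i ∣ ∸ sIdx (λ l → ∣ A l ∣) i j))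
                      ≡ sizes j * 2 ^ (sum sizes ∸ prefixSum sizes j)
    pointwise j rewrite sum-sizes | ΣFin≡sum k (λ l → if does (toℕ l ≤? toℕ j) then sizes l else 0) with j ≟ i
    ... | yes _ = refl
    ... | no  _ = refl

lemma4p11 : ∀ {m : ℕ} (G : TCM m) (k : ℕ) (A : Fin k → Subset m) →
    (∀ j → MaximalClosed G (A j)) →
    (∀ S → MaximalClosed G S → ∃ λ j → A j ≡ S) →
    (∀ j j′ → A j ≡ A j′ → j ≡ j′) →
    (∀ j j′ → toℕ j ≤ℕ toℕ j′ → ∣ A j ∣ ≤ℕ ∣ A j′ ∣) →
    (i : Fin k) (v : Fin m) → v ∈ A i →
    lhsSum G (A i) v ≤ℕ rhsSum m (λ j → ∣ A j ∣) i
lemma4p11 G k A maximal complete distinct sorted i v v∈Aᵢ = begin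
  lhsSum G (A i) v                  ≤⟨ lhsSum≤∑2^outdeg ⟩
  ∑2^outdeg W                       ≤⟨ bounded (size W) W refl class asymmetric multipartite (classSize-sorted sorted) ⟩
  classBound k (classSize W class)  ≡⟨ classBound-cong k classSize≗sizes ⟩
  classBound k sizes                ≡⟨ classBound≡rhsSum ⟩
  rhsSum _ (λ j → ∣ A j ∣) i        ∎
  where
  open ≤-Reasoning
  open Outside G A maximal complete distinct i v v∈Aᵢ
  open OrientedGraph arc
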